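{- Let $S=S[1..n]$ be a string, let $0\le k\le n-1$, let $p$ be a position, and let $S[i..j]$ be a $k$-mismatch SUS covering $p$. Then one of the following holds: (a) $S[i..j]$ is an $\mathrm{SLS}_p^k$, i.e. a shortest $k$-mismatch LSUS covering $p$; (b) $j=p$, and $\mathrm{LSUS}_i^k$ exists and satisfies $i+|\mathrm{LSUS}_i^k|-1<p$. In this case $S[i..p]$ is a right extension, through position $p$, of $\mathrm{LSUS}_i^k$.
   Context: For $1\le i\le j\le n$, $S[i..j]=S[i]\cdots S[j]$ is a substring of length $j-i+1$, and it covers position $q$ if $i\le q\le j$. $H$ denotes the Hamming distance between equal-length strings. For an integer $k\ge 0$, a substring $S[i..j]$ is $k$-mismatch unique if there is no substring $S[i'..j']$ with $i'\ne i$, $j'-i'=j-i$ and $H(S[i..j],S[i'..j'])\le k$. A $k$-mismatch SUS covering $p$ is a $k$-mismatch unique substring covering $p$ of minimum length among all such substrings. $\mathrm{LSUS}_p^k$ is the shortest $k$-mismatch unique substring starting at position $p$, if one exists. The strings $\mathrm{LSUS}_q^k$, over all positions $q$ for which they exist, are called $k$-mismatch LSUSes. An $\mathrm{SLS}_p^k$ is a $k$-mismatch LSUS covering $p$ of minimum length among all $k$-mismatch LSUSes covering $p$. It may not exist and may not be unique. -}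

module Defs where

open import Data.Nat using (ℕ; zero; suc; _+_; _∸_; _≤_; _<_; pred)
open import Data.Vec using (Vec; []; _∷_)
open import Data.Maybe using (Maybe; just; nothing)
import Data.Maybe.Properties as MP
open import Data.Product using (Σ; _×_; _,_)
open import Relation.Binary.Definitions using (DecidableEquality)
open import Relation.Binary.PropositionalEquality using (_≡_; _≢_)
open import Relation.Nullary using (yes; no)

-- Strings S = S[1..n] are vectors over an alphabet A with decidable equality.
-- Positions are 1-based natural numbers; a substring S[i..j] is given by (i , j).

module _ {A : Set} (_≟A_ : DecidableEquality A) where

  at : ∀ {n} → Vec A n → ℕ → Maybe A
  at []       _       = nothing
  at (x ∷ xs) zero    = just x
  at (x ∷ xs) (suc q) = at xs q

  chr : ∀ {n} → Vec A n → ℕ → Maybe A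
  chr S q = at S (pred q)

  ham : ∀ {n} → Vec A n → ℕ → ℕ → ℕ → ℕ
  ham S i i' zero = 0
  ham S i i' (suc ℓ) with MP.≡-dec _≟A_ (chr S i) (chr S i')
  ... | yes _ = ham S (suc i) (suc i') ℓ
  ... | no  _ = suc (ham S (suc i) (suc i') ℓ)

  -- Hamming distance H(S[i..j], S[i'..j'])   (used when j - i = j' - i')
  H : ∀ {n} → Vec A n → ℕ → ℕ → ℕ → ℕ
  H S i j i' = ham S i i' (suc (j ∸ i))

  IsSub : ∀ {n} → Vec A n → ℕ → ℕ → Set
  IsSub {n} S i j = 1 ≤ i × i ≤ j × j ≤ n

  Covers : ℕ → ℕ → ℕ → Set
  Covers i j q = i ≤ q × q ≤ j

  Unique : ∀ {n} → Vec A n → ℕ → ℕ → ℕ → Set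
  Unique S k i j = IsSub S i j ×
    (∀ i' j' → IsSub S i' j' → i' ≢ i → j' ∸ i' ≡ j ∸ i → k < H S i j i')

  SUS : ∀ {n} → Vec A n → ℕ → ℕ → ℕ → ℕ → Set
  SUS S k p i j = Unique S k i j × Covers i j p ×
    (∀ i' j' → Unique S k i' j' → Covers i' j' p → j ∸ i ≤ j' ∸ i')

  IsLSUS : ∀ {n} → Vec A n → ℕ → ℕ → ℕ → Set
  IsLSUS S k p j = Unique S k p j × (∀ j' → Unique S k p j' → j ≤ j')

  SLS : ∀ {n} → Vec A n → ℕ → ℕ → ℕ → ℕ → Set
  SLS S k p i j = IsLSUS S k i j × Covers i j p ×
    (∀ i' j' → IsLSUS S k i' j' → Covers i' j' p → j ∸ i ≤ j' ∸ i')

-- Uniqueness is preserved under right extension, and among the unique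
-- substrings starting at i there is a shortest one, LSUS_i, ending no later
-- than j. If it is S[i..j] itself, then S[i..j] is an LSUS, and since it is
-- shortest among all unique substrings covering p, it is an SLS_p. Otherwise
-- LSUS_i is shorter than the SUS, so it cannot cover p and ends before p;
-- its right extension S[i..p] is then unique and covers p, and minimality of
-- the SUS forces j = p.
module Submission where

open import Defs
open import Data.Nat using (ℕ; suc; _+_; _∸_; _≤_; _<_; _≤?_; _<?_; _≟_; z≤n; s≤s)
open import Data.Nat.Properties
open import Data.Nat.Induction using (<-rec)
open import Data.Vec using (Vec)
open import Data.Product using (Σ; ∃; _×_; _,_; proj₁)
open import Data.Sum using (_⊎_; inj₁; inj₂)
import Data.Maybe.Properties as MP
open import Relation.Binary.Definitions using (DecidableEquality)
open import Relation.Binary.PropositionalEquality using (_≡_; _≢_; refl; sym; trans; cong)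
open import Relation.Nullary using (Dec; yes; no)
open import Relation.Nullary.Decidable using (map′; _×-dec_; _→-dec_; ¬?)
open import Relation.Unary using (Pred; Decidable)

m∸o≤n∸o⇒m≤n : ∀ {m n o} → o ≤ n → m ∸ o ≤ n ∸ o → m ≤ n
m∸o≤n∸o⇒m≤n {m} {n} {o} o≤n le = begin
  m            ≤⟨ m≤n+m∸n m o ⟩
  o + (m ∸ o)  ≤⟨ +-monoʳ-≤ o le ⟩
  o + (n ∸ o)  ≡⟨ m+[n∸m]≡n o≤n ⟩
  n            ∎
  where open ≤-Reasoning

least-witness : ∀ {p} {P : Pred ℕ p} → Decidable P →
                ∀ {y} → P y → ∃ λ x → P x × x ≤ y × (∀ {z} → P z → x ≤ z)
least-witness {P = P} P? {y} = <-rec Goal step y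
  where
  Goal : ℕ → Set _
  Goal y = P y → ∃ λ x → P x × x ≤ y × (∀ {z} → P z → x ≤ z)

  step : ∀ y → (∀ {z} → z < y → Goal z) → Goal y
  step y smaller py with anyUpTo? P? y
  ... | no none = y , py , ≤-refl , λ {z} pz → ≮⇒≥ λ z<y → none (z , z<y , pz)
  ... | yes (z , z<y , pz) with smaller z<y pz
  ...   | x , px , x≤z , least = x , px , ≤-trans x≤z (<⇒≤ z<y) , least

window-end : ∀ {i j ℓ} → i ≤ j → j ∸ i ≡ ℓ → i + ℓ ≡ j
window-end {i} i≤j eq = trans (cong (i +_) (sym eq)) (m+[n∸m]≡n i≤j)

module _ {A : Set} (_≟A_ : DecidableEquality A) {n : ℕ} (S : Vec A n) where

  ham-mono-≤ : ∀ {i i' ℓ ℓ'} → ℓ ≤ ℓ' → ham _≟A_ S i i' ℓ ≤ ham _≟A_ S i i' ℓ'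
  ham-mono-≤ z≤n = z≤n
  ham-mono-≤ {i} {i'} (s≤s ℓ≤ℓ') with MP.≡-dec _≟A_ (chr _≟A_ S i) (chr _≟A_ S i')
  ... | yes _ = ham-mono-≤ ℓ≤ℓ'
  ... | no  _ = s≤s (ham-mono-≤ ℓ≤ℓ')

  module _ (k : ℕ) where

    Unique-extendʳ : ∀ {i y z} → Unique _≟A_ S k i y → y ≤ z → z ≤ n → Unique _≟A_ S k i z
    Unique-extendʳ {i} {y} {z} ((1≤i , i≤y , _) , far) y≤z z-in-range =
      (1≤i , ≤-trans i≤y y≤z , z-in-range) , far′
      where
      far′ : ∀ i' j' → IsSub _≟A_ S i' j' → i' ≢ i → j' ∸ i' ≡ z ∸ i →
             k < H _≟A_ S i z i'
      far′ i' j' (1≤i' , i'≤j' , j'≤n) i'≢i len = begin-strict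
        k                  <⟨ far i' (i' + (y ∸ i)) shorter-window i'≢i (m+n∸m≡n i' _) ⟩
        H _≟A_ S i y i'    ≤⟨ ham-mono-≤ (s≤s (∸-monoˡ-≤ i y≤z)) ⟩
        H _≟A_ S i z i'    ∎
        where
        open ≤-Reasoning
        shorter-window : IsSub _≟A_ S i' (i' + (y ∸ i))
        shorter-window = 1≤i' , m≤m+n i' _ ,
          ≤-trans (+-monoʳ-≤ i' (∸-monoˡ-≤ i y≤z))
                  (≤-trans (≤-reflexive (window-end i'≤j' len)) j'≤n)

    -- Uniqueness quantifies over windows (i' , j'), but j' is determined by i',
    -- so it suffices to check the finitely many starts i' ≤ n.
    Far : ℕ → ℕ → ℕ → Set
    Far i j i' = 1 ≤ i' → i' ≢ i → i' + (j ∸ i) ≤ n → k < H _≟A_ S i j i'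

    Unique? : ∀ i j → Dec (Unique _≟A_ S k i j)
    Unique? i j = map′ to from (IsSub? ×-dec allUpTo? Far? (suc n))
      where
      IsSub? : Dec (IsSub _≟A_ S i j)
      IsSub? = (1 ≤? i) ×-dec ((i ≤? j) ×-dec (j ≤? n))

      Far? : Decidable (Far i j)
      Far? i' = (1 ≤? i') →-dec (¬? (i' ≟ i) →-dec
                ((i' + (j ∸ i) ≤? n) →-dec (k <? H _≟A_ S i j i')))

      to : IsSub _≟A_ S i j × (∀ {i'} → i' < suc n → Far i j i') → Unique _≟A_ S k i j
      to (sub , far) = sub , λ i' j' (1≤i' , i'≤j' , j'≤n) i'≢i len →
        far (s≤s (≤-trans i'≤j' j'≤n)) 1≤i' i'≢i
            (≤-trans (≤-reflexive (window-end i'≤j' len)) j'≤n)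

      from : Unique _≟A_ S k i j → IsSub _≟A_ S i j × (∀ {i'} → i' < suc n → Far i j i')
      from (sub , far) = sub , λ {i'} _ 1≤i' i'≢i end≤n →
        far i' (i' + (j ∸ i)) (1≤i' , m≤m+n i' _ , end≤n) i'≢i (m+n∸m≡n i' _)

    Unique⇒LSUS : ∀ {i j} → Unique _≟A_ S k i j →
                  ∃ λ jL → IsLSUS _≟A_ S k i jL × jL ≤ j
    Unique⇒LSUS {i} u with least-witness (Unique? i) u
    ... | jL , uL , jL≤j , least = jL , (uL , λ _ u' → least u') , jL≤j

    SUS-shortest-from-start : ∀ {p i j y} → SUS _≟A_ S k p i j →
                              Unique _≟A_ S k i y → p ≤ y → j ≤ y
    SUS-shortest-from-start (_ , (i≤p , p≤j) , shortest) u p≤y =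
      m∸o≤n∸o⇒m≤n i≤y (shortest _ _ u (i≤p , p≤y))
      where i≤y = ≤-trans i≤p p≤y

lemma3 : {A : Set} (_≟A_ : DecidableEquality A) (n : ℕ) (S : Vec A n)
         (k p i j : ℕ) → k < n → 1 ≤ p → p ≤ n →
         SUS _≟A_ S k p i j →
         SLS _≟A_ S k p i j
         ⊎ (j ≡ p × Σ ℕ (λ jL → IsLSUS _≟A_ S k i jL × jL < p))
lemma3 _≟A_ n S k p i j _ _ p≤n sus@(u , covers@(_ , p≤j) , shortest)
  with Unique⇒LSUS _≟A_ S k u
... | jL , lsus , jL≤j with m≤n⇒m<n∨m≡n jL≤j
...   | inj₂ refl = inj₁ (lsus , covers , λ i' j' lsus' → shortest i' j' (proj₁ lsus'))
...   | inj₁ jL<j = inj₂ (j≡p , jL , lsus , jL<p)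
  where
  jL<p : jL < p
  jL<p = ≰⇒> λ p≤jL → <⇒≱ jL<j (SUS-shortest-from-start _≟A_ S k sus (proj₁ lsus) p≤jL)

  j≡p : j ≡ p
  j≡p = ≤-antisym
    (SUS-shortest-from-start _≟A_ S k sus
      (Unique-extendʳ _≟A_ S k (proj₁ lsus) (<⇒≤ jL<p) p≤n) ≤-refl)
    p≤j
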